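{- For every $k\in\mathbb{N}\cup\{\infty\}$, $(\mathsf{DMTS},\chi,\trianglelefteq_k)$ is a specification theory for $\mathsf{LTS}$ adequate for $\approx_k$, and $(\mathsf{DMTS},\chi,\trianglelefteq_k^{\mathrm r})$ is a specification theory for $\mathsf{LTS}$ adequate for $\approx_k^{\mathrm r}$.
   Context: Fix a finite alphabet $\Sigma$. An LTS is $(S,s^0,T)$ with $S$ finite, $s^0\in S$, $T\subseteq S\times\Sigma\times S$; $\mathsf{LTS}$ is the set of all LTS. $T^*\subseteq S\times\Sigma^*\times S$ is defined by: $(s,\epsilon,s)\in T^*$; if $(s,\tau,t)\in T^*$ and $(t,a,u)\in T$ then $(s,\tau.a,u)\in T^*$. A DMTS is $D=(S,S^0,\dashrightarrow,\longrightarrow)$ with $S$ finite, $S^0\subseteq S$, $\dashrightarrow\subseteq S\times\Sigma\times S$ (written $s\overset{a}{\dashrightarrow}t$), $\longrightarrow\subseteq S\times2^{\Sigma\times S}$ (written $s\longrightarrow N$), such that $s\longrightarrow N$, $(a,t)\in N$ imply $s\overset{a}{\dashrightarrow}t$; $\mathsf{DMTS}$ is the set of all DMTS. For $I=(S,s^0,T)$, $\chi(I)=(S,\{s^0\},T,\{(s,\{(a,t)\})\mid(s,a,t)\in T\})$. For a DMTS define trace relations $\overset{\tau}{\dashrightarrow\!\!\!^*}$ and $\overset{\tau}{\longrightarrow^*}$ on $S$ ($\tau\in\Sigma^*$): $s\overset{\epsilon}{\dashrightarrow^*}s$ and $s\overset{\epsilon}{\longrightarrow^*}s$; if $s\overset{\tau}{\dashrightarrow^*}t$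 and $t\overset{a}{\dashrightarrow}u$ then $s\overset{\tau.a}{\dashrightarrow^*}u$; if $s\overset{\tau}{\longrightarrow^*}t$, $t\longrightarrow N$ and $(a,u)\in N$ then $s\overset{\tau.a}{\longrightarrow^*}u$. Indices $j$ range over $\{0,\dots,k\}$ (over $\mathbb{N}$ when $k=\infty$, in which case "$j<k$" always holds and the "ready" extra conditions, which concern the last relation, are vacuous). LTS: for $I_i=(S_i,s^0_i,T_i)$, a linear $k$-switching relation family from $I_1$ to $I_2$ is $R^0,\dots,R^k\subseteq S_1\times S_2$ with $(s^0_1,s^0_2)\in R^0$ and: for even $j$ and $(s_1,s_2)\in R^j$: for every $(s_1,\tau,t_1)\in T_1^*$ there is $(s_2,\tau,t_2)\in T_2^*$, and if $j<k$, for every $(s_1,\tau,t_1)\in T_1^*$ there is $(s_2,\tau,t_2)\in T_2^*$ with $(t_1,t_2)\in R^{j+1}$; for odd $j$ and $(s_1,s_2)\in R^j$: for every $(s_2,\tau,t_2)\in T_2^*$ there is $(s_1,\tau,t_1)\in T_1^*$, and if $j<k$, for every $(s_2,\tau,t_2)\in T_2^*$ there is $(s_1,\tau,t_1)\in T_1^*$ with $(t_1,t_2)\in R^{j+1}$. A linear $k$-ready relation family additionally satisfies for all $(s_1,s_2)\in R^k$: if $k$ is even, for every $(s_1,\tau,t_1)\in T_1^*$ there is $(s_2,\tau,t_2)\in T_2^*$ such that for every $(t_2,a,u_2)\in T_2$ there is some $(t_1,a,u_1)\in T_1$; if $k$ is odd, for every $(s_2,\tau,t_2)\in T_2^*$ there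 is $(s_1,\tau,t_1)\in T_1^*$ such that for every $(t_1,a,u_1)\in T_1$ there is some $(t_2,a,u_2)\in T_2$. $I_1\approx_kI_2$ iff there are linear $k$-switching relation families from $I_1$ to $I_2$ and from $I_2$ to $I_1$; $I_1\approx_k^{\mathrm r}I_2$ likewise with linear $k$-ready families. DMTS: for $D_i=(S_i,S^0_i,\dashrightarrow_i,\longrightarrow_i)$ and $R\subseteq S_1\times S_2$, say $(s_1,s_2)$ satisfies LMAY$(R)$ if for every $s_1\overset{\tau}{\dashrightarrow^*_1}t_1$ there is $s_2\overset{\tau}{\dashrightarrow^*_2}t_2$ with $(t_1,t_2)\in R$, LMAY if the same holds without the requirement $(t_1,t_2)\in R$, LMUST$(R)$ if for every $s_2\overset{\tau}{\longrightarrow^*_2}t_2$ there is $s_1\overset{\tau}{\longrightarrow^*_1}t_1$ with $(t_1,t_2)\in R$, and LMUST likewise without $R$. A linear $k$-switching relation family from $D_1$ to $D_2$ is $R_1^0,\dots,R_1^k,R_2^0,\dots,R_2^k\subseteq S_1\times S_2$ with: every $s^0_1\in S^0_1$ has $s^0_2\in S^0_2$ with $(s^0_1,s^0_2)\in R_1^0$, every $s^0_2\in S^0_2$ has $s^0_1\in S^0_1$ with $(s^0_1,s^0_2)\in R_2^0$; for even $j$, pairs in $R_1^j$ satisfy LMAY and, if $j<k$, LMAY$(R_1^{j+1})$; for odd $j$, pairs in $R_1^j$ satisfy LMUST and, if $j<k$, LMUST$(R_1^{j+1})$; for even $j$, pairs in $R_2^j$ satisfy LMUST and, if $j<k$, LMUST$(R_2^{j+1})$;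 for odd $j$, pairs in $R_2^j$ satisfy LMAY and, if $j<k$, LMAY$(R_2^{j+1})$. A linear $k$-ready relation family additionally satisfies, writing (A) for "for every $s_1\overset{\tau}{\dashrightarrow^*_1}t_1$ there is $s_2\overset{\tau}{\dashrightarrow^*_2}t_2$ such that for every $t_2\longrightarrow_2N_2$ there is $t_1\longrightarrow_1N_1$ such that for every $(a,u_1)\in N_1$ there is some $(a,u_2)\in N_2$" and (B) for "for every $s_2\overset{\tau}{\longrightarrow^*_2}t_2$ there is $s_1\overset{\tau}{\longrightarrow^*_1}t_1$ such that for every $t_1\overset{a}{\dashrightarrow}_1u_1$ there is some $t_2\overset{a}{\dashrightarrow}_2u_2$": if $k$ is even, every $(s_1,s_2)\in R_1^k$ satisfies (A) and every $(s_1,s_2)\in R_2^k$ satisfies (B); if $k$ is odd, every $(s_1,s_2)\in R_1^k$ satisfies (B) and every $(s_1,s_2)\in R_2^k$ satisfies (A). $D_1\trianglelefteq_kD_2$ iff there is a linear $k$-switching relation family from $D_1$ to $D_2$; $D_1\trianglelefteq_k^{\mathrm r}D_2$ iff there is a linear $k$-ready one. A specification theory for a set $\mathsf{Proc}$ is a triple $(\mathsf{Spec},\chi,\le)$, $\chi:\mathsf{Proc}\to\mathsf{Spec}$, $\le$ a preorder on $\mathsf{Spec}$, such that with $I\models S$ iff $\chi(I)\le S$, for each $I$: $I\models\chi(I)$ and every $I'\models\chi(I)$ has $\mathrm{Th}(I')=\mathrm{Th}(I)$, where $\mathrm{Th}(I)=\{S\mid I\models S\}$. It is adequate for an equivalence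 $\sim$ on $\mathsf{Proc}$ if $\mathrm{Th}(I_1)=\mathrm{Th}(I_2)\iff I_1\sim I_2$. -}

module Defs where

open import Data.Nat using (ℕ; zero; suc; _≤_; _<_; _%_)
open import Data.Fin using (Fin)
open import Data.List using (List; []; _∷ʳ_)
open import Data.Product using (Σ; ∃; ∃-syntax; _×_; _,_)
open import Data.Unit using (⊤)
open import Relation.Binary.PropositionalEquality using (_≡_; refl)

data ℕ∞ : Set where
  fin : ℕ → ℕ∞
  ∞   : ℕ∞

_≤∞_ : ℕ → ℕ∞ → Set
j ≤∞ fin k = j ≤ k
j ≤∞ ∞     = ⊤

_<∞_ : ℕ → ℕ∞ → Set
j <∞ fin k = j < k
j <∞ ∞     = ⊤

Even : ℕ → Set
Even j = j % 2 ≡ 0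

Odd : ℕ → Set
Odd j = j % 2 ≡ 1

module Theory (A : Set) where

  data Tr {S : Set} (T : S → A → S → Set) : S → List A → S → Set where
    ε    : ∀ {s} → Tr T s [] s
    snoc : ∀ {s τ t a u} → Tr T s τ t → T t a u → Tr T s (τ ∷ʳ a) u

  record LTS : Set₁ where
    field
      n  : ℕ
      s0 : Fin n
      T  : Fin n → A → Fin n → Set

  -- The must relation ⟶ ⊆ S × 2^(A×S) is given per state s by an index set
  -- Must s and, for i : Must s, the set N = mset s i ⊆ A × S;
  -- s ⟶ N  iff  N = mset s i for some i : Must s.
  record DMTS : Set₁ where
    field
      n        : ℕ
      S0       : Fin n → Set
      may      : Fin n → A → Fin n → Set
      Must     : Fin n → Set
      mset     : (s : Fin n) → Must s → A → Fin n → Set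
      must⊆may : ∀ s (i : Must s) a t → mset s i a t → may s a t

    mustStep : Fin n → A → Fin n → Set
    mustStep s a t = Σ (Must s) λ i → mset s i a t

    MayTr : Fin n → List A → Fin n → Set
    MayTr = Tr may

    MustTr : Fin n → List A → Fin n → Set
    MustTr = Tr mustStep

  χ : LTS → DMTS
  χ I = record
    { n        = n
    ; S0       = λ s → s ≡ s0
    ; may      = T
    ; Must     = λ s → Σ A λ a → Σ (Fin n) λ t → T s a t
    ; mset     = λ s i b u → singleton i b u
    ; must⊆may = λ { s (a , t , p) .a .t (refl , refl) → p }
    }
    where
      open LTS I
      singleton : ∀ {s} → (Σ A λ a → Σ (Fin n) λ t → T s a t) → A → Fin n → Set
      singleton (a , t , _) b u = (b ≡ a) × (u ≡ t)

  module _ (I₁ I₂ : LTS) where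
    private
      module I₁ = LTS I₁
      module I₂ = LTS I₂

    -- conditions on a family R⁰,R¹,… (indexed by ℕ; only j ≤ k matter)
    LinSwitchingL : ℕ∞ → (ℕ → Fin I₁.n → Fin I₂.n → Set) → Set
    LinSwitchingL k R =
      R 0 I₁.s0 I₂.s0 ×
      (∀ j → j ≤∞ k → ∀ s₁ s₂ → R j s₁ s₂ →
        (Even j →
          (∀ τ t₁ → Tr I₁.T s₁ τ t₁ → ∃[ t₂ ] Tr I₂.T s₂ τ t₂) ×
          (j <∞ k → ∀ τ t₁ → Tr I₁.T s₁ τ t₁ →
             ∃[ t₂ ] (Tr I₂.T s₂ τ t₂ × R (suc j) t₁ t₂))) ×
        (Odd j →
          (∀ τ t₂ → Tr I₂.T s₂ τ t₂ → ∃[ t₁ ] Tr I₁.T s₁ τ t₁) ×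
          (j <∞ k → ∀ τ t₂ → Tr I₂.T s₂ τ t₂ →
             ∃[ t₁ ] (Tr I₁.T s₁ τ t₁ × R (suc j) t₁ t₂))))

    ReadyExtraL : ℕ∞ → (ℕ → Fin I₁.n → Fin I₂.n → Set) → Set
    ReadyExtraL ∞       R = ⊤
    ReadyExtraL (fin k) R = ∀ s₁ s₂ → R k s₁ s₂ →
      (Even k → ∀ τ t₁ → Tr I₁.T s₁ τ t₁ → ∃[ t₂ ] (Tr I₂.T s₂ τ t₂ ×
         (∀ a u₂ → I₂.T t₂ a u₂ → ∃[ u₁ ] I₁.T t₁ a u₁))) ×
      (Odd k → ∀ τ t₂ → Tr I₂.T s₂ τ t₂ → ∃[ t₁ ] (Tr I₁.T s₁ τ t₁ ×
         (∀ a u₁ → I₁.T t₁ a u₁ → ∃[ u₂ ] I₂.T t₂ a u₂)))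

    LinSwitchingFamL : ℕ∞ → Set₁
    LinSwitchingFamL k = ∃[ R ] LinSwitchingL k R

    LinReadyFamL : ℕ∞ → Set₁
    LinReadyFamL k = ∃[ R ] (LinSwitchingL k R × ReadyExtraL k R)

  _≈[_]_ : LTS → ℕ∞ → LTS → Set₁
  I₁ ≈[ k ] I₂ = LinSwitchingFamL I₁ I₂ k × LinSwitchingFamL I₂ I₁ k

  _≈ʳ[_]_ : LTS → ℕ∞ → LTS → Set₁
  I₁ ≈ʳ[ k ] I₂ = LinReadyFamL I₁ I₂ k × LinReadyFamL I₂ I₁ k

  module _ (D₁ D₂ : DMTS) where
    private
      module D₁ = DMTS D₁
      module D₂ = DMTS D₂

    Rel : Set₁
    Rel = Fin D₁.n → Fin D₂.n → Set

    LMAY : Fin D₁.n → Fin D₂.n → Set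
    LMAY s₁ s₂ = ∀ τ t₁ → D₁.MayTr s₁ τ t₁ → ∃[ t₂ ] D₂.MayTr s₂ τ t₂

    LMAYR : Rel → Fin D₁.n → Fin D₂.n → Set
    LMAYR R s₁ s₂ = ∀ τ t₁ → D₁.MayTr s₁ τ t₁ → ∃[ t₂ ] (D₂.MayTr s₂ τ t₂ × R t₁ t₂)

    LMUST : Fin D₁.n → Fin D₂.n → Set
    LMUST s₁ s₂ = ∀ τ t₂ → D₂.MustTr s₂ τ t₂ → ∃[ t₁ ] D₁.MustTr s₁ τ t₁

    LMUSTR : Rel → Fin D₁.n → Fin D₂.n → Set
    LMUSTR R s₁ s₂ = ∀ τ t₂ → D₂.MustTr s₂ τ t₂ → ∃[ t₁ ] (D₁.MustTr s₁ τ t₁ × R t₁ t₂)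

    CondA : Fin D₁.n → Fin D₂.n → Set
    CondA s₁ s₂ = ∀ τ t₁ → D₁.MayTr s₁ τ t₁ → ∃[ t₂ ] (D₂.MayTr s₂ τ t₂ ×
      (∀ (i₂ : D₂.Must t₂) → Σ (D₁.Must t₁) λ i₁ →
         ∀ a u₁ → D₁.mset t₁ i₁ a u₁ → ∃[ u₂ ] D₂.mset t₂ i₂ a u₂))

    CondB : Fin D₁.n → Fin D₂.n → Set
    CondB s₁ s₂ = ∀ τ t₂ → D₂.MustTr s₂ τ t₂ → ∃[ t₁ ] (D₁.MustTr s₁ τ t₁ ×
      (∀ a u₁ → D₁.may t₁ a u₁ → ∃[ u₂ ] D₂.may t₂ a u₂))

    LinSwitchingD : ℕ∞ → (ℕ → Rel) → (ℕ → Rel) → Set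
    LinSwitchingD k R₁ R₂ =
      (∀ s₁ → D₁.S0 s₁ → ∃[ s₂ ] (D₂.S0 s₂ × R₁ 0 s₁ s₂)) ×
      (∀ s₂ → D₂.S0 s₂ → ∃[ s₁ ] (D₁.S0 s₁ × R₂ 0 s₁ s₂)) ×
      (∀ j → j ≤∞ k → ∀ s₁ s₂ → R₁ j s₁ s₂ →
        (Even j → LMAY s₁ s₂ × (j <∞ k → LMAYR (R₁ (suc j)) s₁ s₂)) ×
        (Odd j → LMUST s₁ s₂ × (j <∞ k → LMUSTR (R₁ (suc j)) s₁ s₂))) ×
      (∀ j → j ≤∞ k → ∀ s₁ s₂ → R₂ j s₁ s₂ →
        (Even j → LMUST s₁ s₂ × (j <∞ k → LMUSTR (R₂ (suc j)) s₁ s₂)) ×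
        (Odd j → LMAY s₁ s₂ × (j <∞ k → LMAYR (R₂ (suc j)) s₁ s₂)))

    ReadyExtraD : ℕ∞ → (ℕ → Rel) → (ℕ → Rel) → Set
    ReadyExtraD ∞       R₁ R₂ = ⊤
    ReadyExtraD (fin k) R₁ R₂ =
      (Even k → (∀ s₁ s₂ → R₁ k s₁ s₂ → CondA s₁ s₂) ×
                (∀ s₁ s₂ → R₂ k s₁ s₂ → CondB s₁ s₂)) ×
      (Odd k → (∀ s₁ s₂ → R₁ k s₁ s₂ → CondB s₁ s₂) ×
               (∀ s₁ s₂ → R₂ k s₁ s₂ → CondA s₁ s₂))

  _⊴[_]_ : DMTS → ℕ∞ → DMTS → Set₁
  D₁ ⊴[ k ] D₂ = Σ (ℕ → Rel D₁ D₂) λ R₁ → Σ (ℕ → Rel D₁ D₂) λ R₂ →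
    LinSwitchingD D₁ D₂ k R₁ R₂

  _⊴ʳ[_]_ : DMTS → ℕ∞ → DMTS → Set₁
  D₁ ⊴ʳ[ k ] D₂ = Σ (ℕ → Rel D₁ D₂) λ R₁ → Σ (ℕ → Rel D₁ D₂) λ R₂ →
    LinSwitchingD D₁ D₂ k R₁ R₂ × ReadyExtraD D₁ D₂ k R₁ R₂

module _ {Proc Spec : Set₁} (χ' : Proc → Spec) (_≤_ : Spec → Spec → Set₁) where

  _⊨_ : Proc → Spec → Set₁
  I ⊨ S = χ' I ≤ S

  SameTh : Proc → Proc → Set₁
  SameTh I₁ I₂ = ∀ S → (I₁ ⊨ S → I₂ ⊨ S) × (I₂ ⊨ S → I₁ ⊨ S)

  IsSpecTheory : Set₁
  IsSpecTheory =
    (∀ S → S ≤ S) ×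
    (∀ S₁ S₂ S₃ → S₁ ≤ S₂ → S₂ ≤ S₃ → S₁ ≤ S₃) ×
    (∀ I → I ⊨ χ' I) ×
    (∀ I I' → I' ⊨ χ' I → SameTh I' I)

  AdequateFor : (Proc → Proc → Set₁) → Set₁
  AdequateFor _∼_ = ∀ I₁ I₂ → (SameTh I₁ I₂ → I₁ ∼ I₂) × (I₁ ∼ I₂ → SameTh I₁ I₂)

-- Both statements are instances of one abstract fact: if ≤ is a preorder and
-- χ I₁ ≤ χ I₂ ⇔ I₁ ∼ I₂ for a symmetric ∼, then Th(I) is determined by χ I and
-- (Spec, χ, ≤) is a specification theory adequate for ∼. Reflexivity and
-- transitivity of ⊴ₖ hold level by level, composing the relation families.
-- On images of χ the may-traces are the traces of the LTS, and since every
-- must-set is a singleton so are the must-traces; hence the LMAY/LMUST clauses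
-- of a DMTS family become the two directions of a pair of LTS families (R₂
-- read backwards), and conditions (A)/(B) become the LTS ready conditions.
module Submission where

open import Defs
open import Data.Nat using (ℕ)
open import Data.Fin using (Fin)
open import Data.Product using (_×_; _,_; proj₁; proj₂; Σ; ∃-syntax; map; map₁; map₂; zip′; swap; uncurry)
open import Data.Unit using (tt)
open import Function using (_∘_; flip)
open import Relation.Binary.PropositionalEquality using (_≡_; refl)

adequateSpecTheory : {Proc Spec : Set₁} (χ' : Proc → Spec)
  (_≤_ : Spec → Spec → Set₁) (_∼_ : Proc → Proc → Set₁) →
  (∀ S → S ≤ S) →
  (∀ S₁ S₂ S₃ → S₁ ≤ S₂ → S₂ ≤ S₃ → S₁ ≤ S₃) →
  (∀ I₁ I₂ → χ' I₁ ≤ χ' I₂ → I₁ ∼ I₂) →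
  (∀ I₁ I₂ → I₁ ∼ I₂ → χ' I₁ ≤ χ' I₂) →
  (∀ I₁ I₂ → I₁ ∼ I₂ → I₂ ∼ I₁) →
  IsSpecTheory χ' _≤_ × AdequateFor χ' _≤_ _∼_
adequateSpecTheory χ' _≤_ _∼_ ≤-refl ≤-trans χ≤⇒∼ ∼⇒χ≤ ∼-sym =
  (≤-refl , ≤-trans , (λ I → ≤-refl (χ' I)) , λ I I' → sameTh-of-χ≤ I' I) ,
  λ I₁ I₂ → (λ same → χ≤⇒∼ I₁ I₂ (proj₂ (same (χ' I₂)) (≤-refl (χ' I₂)))) ,
            sameTh-of-χ≤ I₁ I₂ ∘ ∼⇒χ≤ I₁ I₂
  where
  sameTh-of-χ≤ : ∀ I₁ I₂ → χ' I₁ ≤ χ' I₂ → SameTh χ' _≤_ I₁ I₂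
  sameTh-of-χ≤ I₁ I₂ le S =
    ≤-trans _ _ _ (∼⇒χ≤ I₂ I₁ (∼-sym I₁ I₂ (χ≤⇒∼ I₁ I₂ le))) , ≤-trans _ _ _ le

-- The shape  Even j → LMAY × (j <∞ k → LMAYR …)  of every switching clause.
clause-∘ : {P Q X₁ X₂ X₃ Y₁ Y₂ Y₃ : Set} →
  (X₁ → X₂ → X₃) → (Y₁ → Y₂ → Y₃) →
  (P → X₁ × (Q → Y₁)) → (P → X₂ × (Q → Y₂)) → P → X₃ × (Q → Y₃)
clause-∘ f g c c′ p = zip′ f (λ y y′ q → g (y q) (y′ q)) (c p) (c′ p)

-- Relation.Binary.Construct.Composition._;_ cannot be named: ';' lexes as a separator.
_⨾_ : {X Y Z : Set} → (X → Y → Set) → (Y → Z → Set) → X → Z → Set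
(R ⨾ R′) x z = ∃[ y ] (R x y × R′ y z)

⨾-closed : {X Y Z : Set} {C₁₂ : X → Y → Set} {C₂₃ : Y → Z → Set} {C₁₃ : X → Z → Set}
  {R : X → Y → Set} {R′ : Y → Z → Set} →
  (∀ {x y z} → C₁₂ x y → C₂₃ y z → C₁₃ x z) →
  (∀ x y → R x y → C₁₂ x y) → (∀ y z → R′ y z → C₂₃ y z) →
  ∀ x z → (R ⨾ R′) x z → C₁₃ x z
⨾-closed trans c c′ x z (y , r , r′) = trans (c x y r) (c′ y z r′)

∃-≡-elim : {X : Set} {P : X → Set} {y : X} → ∃[ x ] (x ≡ y × P x) → P y
∃-≡-elim (_ , refl , p) = p

module _ {A : Set} where
  open Theory A

  module Composition (D₁ D₂ D₃ : DMTS) where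
    LMAY-trans : ∀ {s₁ s₂ s₃} → LMAY D₁ D₂ s₁ s₂ → LMAY D₂ D₃ s₂ s₃ → LMAY D₁ D₃ s₁ s₃
    LMAY-trans f g τ t₁ tr₁ = let (t₂ , tr₂) = f τ t₁ tr₁ in g τ t₂ tr₂

    LMAYR-trans : ∀ {R R′ s₁ s₂ s₃} → LMAYR D₁ D₂ R s₁ s₂ → LMAYR D₂ D₃ R′ s₂ s₃ →
                  LMAYR D₁ D₃ (R ⨾ R′) s₁ s₃
    LMAYR-trans f g τ t₁ tr₁ =
      let (t₂ , tr₂ , r) = f τ t₁ tr₁ ; (t₃ , tr₃ , r′) = g τ t₂ tr₂
      in t₃ , tr₃ , t₂ , r , r′

    LMUST-trans : ∀ {s₁ s₂ s₃} → LMUST D₁ D₂ s₁ s₂ → LMUST D₂ D₃ s₂ s₃ → LMUST D₁ D₃ s₁ s₃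
    LMUST-trans f g τ t₃ tr₃ = let (t₂ , tr₂) = g τ t₃ tr₃ in f τ t₂ tr₂

    LMUSTR-trans : ∀ {R R′ s₁ s₂ s₃} → LMUSTR D₁ D₂ R s₁ s₂ → LMUSTR D₂ D₃ R′ s₂ s₃ →
                   LMUSTR D₁ D₃ (R ⨾ R′) s₁ s₃
    LMUSTR-trans f g τ t₃ tr₃ =
      let (t₂ , tr₂ , r′) = g τ t₃ tr₃ ; (t₁ , tr₁ , r) = f τ t₂ tr₂
      in t₁ , tr₁ , t₂ , r , r′

    CondA-trans : ∀ {s₁ s₂ s₃} → CondA D₁ D₂ s₁ s₂ → CondA D₂ D₃ s₂ s₃ → CondA D₁ D₃ s₁ s₃
    CondA-trans f g τ t₁ tr₁ =
      let (t₂ , tr₂ , ready₁₂) = f τ t₁ tr₁ ; (t₃ , tr₃ , ready₂₃) = g τ t₂ tr₂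
      in t₃ , tr₃ , λ i₃ →
        let (i₂ , N₂⊆N₃) = ready₂₃ i₃ ; (i₁ , N₁⊆N₂) = ready₁₂ i₂
        in i₁ , λ a u₁ → uncurry (N₂⊆N₃ a) ∘ N₁⊆N₂ a u₁

    CondB-trans : ∀ {s₁ s₂ s₃} → CondB D₁ D₂ s₁ s₂ → CondB D₂ D₃ s₂ s₃ → CondB D₁ D₃ s₁ s₃
    CondB-trans f g τ t₃ tr₃ =
      let (t₂ , tr₂ , may₂⊆may₃) = g τ t₃ tr₃ ; (t₁ , tr₁ , may₁⊆may₂) = f τ t₂ tr₂
      in t₁ , tr₁ , λ a u₁ → uncurry (may₂⊆may₃ a) ∘ may₁⊆may₂ a u₁

    LinSwitchingD-trans : ∀ k {R₁ R₂ R₁′ R₂′} →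
      LinSwitchingD D₁ D₂ k R₁ R₂ → LinSwitchingD D₂ D₃ k R₁′ R₂′ →
      LinSwitchingD D₁ D₃ k (λ j → R₁ j ⨾ R₁′ j) (λ j → R₂ j ⨾ R₂′ j)
    LinSwitchingD-trans k (init₁ , init₂ , step₁ , step₂) (init₁′ , init₂′ , step₁′ , step₂′) =
      (λ s₁ s₁∈S0 → let (s₂ , s₂∈S0 , r) = init₁ s₁ s₁∈S0 ; (s₃ , s₃∈S0 , r′) = init₁′ s₂ s₂∈S0
                    in s₃ , s₃∈S0 , s₂ , r , r′) ,
      (λ s₃ s₃∈S0 → let (s₂ , s₂∈S0 , r′) = init₂′ s₃ s₃∈S0 ; (s₁ , s₁∈S0 , r) = init₂ s₂ s₂∈S0
                    in s₁ , s₁∈S0 , s₂ , r , r′) ,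
      (λ j j≤k → ⨾-closed
        (zip′ (clause-∘ LMAY-trans LMAYR-trans) (clause-∘ LMUST-trans LMUSTR-trans))
        (step₁ j j≤k) (step₁′ j j≤k)) ,
      (λ j j≤k → ⨾-closed
        (zip′ (clause-∘ LMUST-trans LMUSTR-trans) (clause-∘ LMAY-trans LMAYR-trans))
        (step₂ j j≤k) (step₂′ j j≤k))

    ReadyExtraD-trans : ∀ k {R₁ R₂ R₁′ R₂′} →
      ReadyExtraD D₁ D₂ k R₁ R₂ → ReadyExtraD D₂ D₃ k R₁′ R₂′ →
      ReadyExtraD D₁ D₃ k (λ j → R₁ j ⨾ R₁′ j) (λ j → R₂ j ⨾ R₂′ j)
    ReadyExtraD-trans ∞       _ _ = tt
    ReadyExtraD-trans (fin k) (even , odd) (even′ , odd′) =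
      (λ e → zip′ (⨾-closed CondA-trans) (⨾-closed CondB-trans) (even e) (even′ e)) ,
      (λ o → zip′ (⨾-closed CondB-trans) (⨾-closed CondA-trans) (odd o) (odd′ o))

  module Identity (D : DMTS) where
    LMAY-refl : ∀ s → LMAY D D s s
    LMAY-refl s τ t tr = t , tr

    LMAYR-refl : ∀ s → LMAYR D D _≡_ s s
    LMAYR-refl s τ t tr = t , tr , refl

    LMUST-refl : ∀ s → LMUST D D s s
    LMUST-refl s τ t tr = t , tr

    LMUSTR-refl : ∀ s → LMUSTR D D _≡_ s s
    LMUSTR-refl s τ t tr = t , tr , refl

    CondA-refl : ∀ s → CondA D D s s
    CondA-refl s τ t tr = t , tr , λ i → i , λ a u u∈N → u , u∈N

    CondB-refl : ∀ s → CondB D D s s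
    CondB-refl s τ t tr = t , tr , λ a u t⇢u → u , t⇢u

    LinSwitchingD-refl : ∀ k → LinSwitchingD D D k (λ _ → _≡_) (λ _ → _≡_)
    LinSwitchingD-refl k =
      (λ s s∈S0 → s , s∈S0 , refl) ,
      (λ s s∈S0 → s , s∈S0 , refl) ,
      (λ { j j≤k s .s refl → (λ _ → LMAY-refl s , λ _ → LMAYR-refl s) ,
                             (λ _ → LMUST-refl s , λ _ → LMUSTR-refl s) }) ,
      (λ { j j≤k s .s refl → (λ _ → LMUST-refl s , λ _ → LMUSTR-refl s) ,
                             (λ _ → LMAY-refl s , λ _ → LMAYR-refl s) })

    ReadyExtraD-refl : ∀ k → ReadyExtraD D D k (λ _ → _≡_) (λ _ → _≡_)
    ReadyExtraD-refl ∞       = tt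
    ReadyExtraD-refl (fin k) =
      (λ _ → (λ { s .s refl → CondA-refl s }) , (λ { s .s refl → CondB-refl s })) ,
      (λ _ → (λ { s .s refl → CondB-refl s }) , (λ { s .s refl → CondA-refl s }))

  ⊴-refl : ∀ k D → D ⊴[ k ] D
  ⊴-refl k D = _ , _ , Identity.LinSwitchingD-refl D k

  ⊴ʳ-refl : ∀ k D → D ⊴ʳ[ k ] D
  ⊴ʳ-refl k D = _ , _ , Identity.LinSwitchingD-refl D k , Identity.ReadyExtraD-refl D k

  ⊴-trans : ∀ k D₁ D₂ D₃ → D₁ ⊴[ k ] D₂ → D₂ ⊴[ k ] D₃ → D₁ ⊴[ k ] D₃
  ⊴-trans k D₁ D₂ D₃ (_ , _ , sw) (_ , _ , sw′) =
    _ , _ , Composition.LinSwitchingD-trans D₁ D₂ D₃ k sw sw′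

  ⊴ʳ-trans : ∀ k D₁ D₂ D₃ → D₁ ⊴ʳ[ k ] D₂ → D₂ ⊴ʳ[ k ] D₃ → D₁ ⊴ʳ[ k ] D₃
  ⊴ʳ-trans k D₁ D₂ D₃ (_ , _ , sw , ready) (_ , _ , sw′ , ready′) =
    _ , _ , Composition.LinSwitchingD-trans D₁ D₂ D₃ k sw sw′ ,
            Composition.ReadyExtraD-trans D₁ D₂ D₃ k ready ready′

  module _ (I J : LTS) where
    private
      module I = LTS I
      module J = LTS J

    TraceIncl : Fin I.n → Fin J.n → Set
    TraceIncl s s′ = ∀ τ t → Tr I.T s τ t → ∃[ t′ ] Tr J.T s′ τ t′

    TraceSim : (Fin I.n → Fin J.n → Set) → Fin I.n → Fin J.n → Set
    TraceSim R s s′ = ∀ τ t → Tr I.T s τ t → ∃[ t′ ] (Tr J.T s′ τ t′ × R t t′)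

    ReadyIncl : Fin I.n → Fin J.n → Set
    ReadyIncl s s′ = ∀ τ t → Tr I.T s τ t → ∃[ t′ ] (Tr J.T s′ τ t′ ×
      (∀ a u′ → J.T t′ a u′ → ∃[ u ] I.T t a u))

  module _ (I : LTS) where
    open LTS I

    mustTr-χ⇒tr : ∀ {s τ t} → DMTS.MustTr (χ I) s τ t → Tr T s τ t
    mustTr-χ⇒tr ε = ε
    mustTr-χ⇒tr (snoc tr ((a , u , s⟶u) , refl , refl)) = snoc (mustTr-χ⇒tr tr) s⟶u

    tr⇒mustTr-χ : ∀ {s τ t} → Tr T s τ t → DMTS.MustTr (χ I) s τ t
    tr⇒mustTr-χ ε = ε
    tr⇒mustTr-χ (snoc tr s⟶u) = snoc (tr⇒mustTr-χ tr) ((_ , _ , s⟶u) , refl , refl)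

  module _ {I₁ I₂ : LTS} where
    private
      module I₁ = LTS I₁
      module I₂ = LTS I₂

    LMUST-χ⇒ : ∀ {s₁ s₂} → LMUST (χ I₁) (χ I₂) s₁ s₂ → TraceIncl I₂ I₁ s₂ s₁
    LMUST-χ⇒ h τ t₂ = map₂ (mustTr-χ⇒tr I₁) ∘ h τ t₂ ∘ tr⇒mustTr-χ I₂

    LMUST-χ⇐ : ∀ {s₁ s₂} → TraceIncl I₂ I₁ s₂ s₁ → LMUST (χ I₁) (χ I₂) s₁ s₂
    LMUST-χ⇐ h τ t₂ = map₂ (tr⇒mustTr-χ I₁) ∘ h τ t₂ ∘ mustTr-χ⇒tr I₂

    LMUSTR-χ⇒ : ∀ {R s₁ s₂} → LMUSTR (χ I₁) (χ I₂) R s₁ s₂ → TraceSim I₂ I₁ (flip R) s₂ s₁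
    LMUSTR-χ⇒ h τ t₂ = map₂ (map₁ (mustTr-χ⇒tr I₁)) ∘ h τ t₂ ∘ tr⇒mustTr-χ I₂

    LMUSTR-χ⇐ : ∀ {R s₁ s₂} → TraceSim I₂ I₁ (flip R) s₂ s₁ → LMUSTR (χ I₁) (χ I₂) R s₁ s₂
    LMUSTR-χ⇐ h τ t₂ = map₂ (map₁ (tr⇒mustTr-χ I₁)) ∘ h τ t₂ ∘ mustTr-χ⇒tr I₂

    CondA-χ⇒ : ∀ {s₁ s₂} → CondA (χ I₁) (χ I₂) s₁ s₂ → ReadyIncl I₁ I₂ s₁ s₂
    CondA-χ⇒ h τ t₁ =
      map₂ (map₂ λ ready a u₂ t₂⟶u₂ → matchedLabel t₂⟶u₂ (ready (a , u₂ , t₂⟶u₂))) ∘ h τ t₁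
      where
      -- The must-set {(b , u₁)} of t₁ is contained in {(a , u₂)}, which forces b = a.
      matchedLabel : ∀ {t₁ t₂ a u₂} (t₂⟶u₂ : I₂.T t₂ a u₂) →
        Σ (DMTS.Must (χ I₁) t₁) (λ i₁ → ∀ b u → DMTS.mset (χ I₁) t₁ i₁ b u →
          ∃[ u′ ] DMTS.mset (χ I₂) t₂ (a , u₂ , t₂⟶u₂) b u′) →
        ∃[ u₁ ] I₁.T t₁ a u₁
      matchedLabel _ ((b , u₁ , t₁⟶u₁) , N₁⊆N₂) with N₁⊆N₂ b u₁ (refl , refl)
      ... | _ , refl , _ = u₁ , t₁⟶u₁

    CondA-χ⇐ : ∀ {s₁ s₂} → ReadyIncl I₁ I₂ s₁ s₂ → CondA (χ I₁) (χ I₂) s₁ s₂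
    CondA-χ⇐ h τ t₁ = map₂ (map₂ λ { ready (a , u₂ , t₂⟶u₂) →
      let (u₁ , t₁⟶u₁) = ready a u₂ t₂⟶u₂
      in (a , u₁ , t₁⟶u₁) , λ { _ _ (refl , refl) → u₂ , refl , refl } }) ∘ h τ t₁

    CondB-χ⇒ : ∀ {s₁ s₂} → CondB (χ I₁) (χ I₂) s₁ s₂ → ReadyIncl I₂ I₁ s₂ s₁
    CondB-χ⇒ h τ t₂ = map₂ (map₁ (mustTr-χ⇒tr I₁)) ∘ h τ t₂ ∘ tr⇒mustTr-χ I₂

    CondB-χ⇐ : ∀ {s₁ s₂} → ReadyIncl I₂ I₁ s₂ s₁ → CondB (χ I₁) (χ I₂) s₁ s₂
    CondB-χ⇐ h τ t₂ = map₂ (map₁ (tr⇒mustTr-χ I₁)) ∘ h τ t₂ ∘ mustTr-χ⇒tr I₂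

    LinSwitchingD-χ⇒ : ∀ k {R₁ R₂} → LinSwitchingD (χ I₁) (χ I₂) k R₁ R₂ →
      LinSwitchingL I₁ I₂ k R₁ × LinSwitchingL I₂ I₁ k (flip ∘ R₂)
    LinSwitchingD-χ⇒ k (init₁ , init₂ , step₁ , step₂) =
      (∃-≡-elim (init₁ I₁.s0 refl) ,
       λ j j≤k s₁ s₂ r → map₂ (map LMUST-χ⇒ (LMUSTR-χ⇒ ∘_) ∘_) (step₁ j j≤k s₁ s₂ r)) ,
      (∃-≡-elim (init₂ I₂.s0 refl) ,
       λ j j≤k s₂ s₁ r → map₁ (map LMUST-χ⇒ (LMUSTR-χ⇒ ∘_) ∘_) (step₂ j j≤k s₁ s₂ r))

    LinSwitchingL⇒χ : ∀ k {R R′} → LinSwitchingL I₁ I₂ k R → LinSwitchingL I₂ I₁ k R′ →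
      LinSwitchingD (χ I₁) (χ I₂) k R (flip ∘ R′)
    LinSwitchingL⇒χ k (r₀ , step) (r₀′ , step′) =
      (λ { _ refl → I₂.s0 , refl , r₀ }) ,
      (λ { _ refl → I₁.s0 , refl , r₀′ }) ,
      (λ j j≤k s₁ s₂ r → map₂ (map LMUST-χ⇐ (LMUSTR-χ⇐ ∘_) ∘_) (step j j≤k s₁ s₂ r)) ,
      (λ j j≤k s₁ s₂ r → map₁ (map LMUST-χ⇐ (LMUSTR-χ⇐ ∘_) ∘_) (step′ j j≤k s₂ s₁ r))

    ReadyExtraD-χ⇒ : ∀ k {R₁ R₂} → ReadyExtraD (χ I₁) (χ I₂) k R₁ R₂ →
      ReadyExtraL I₁ I₂ k R₁ × ReadyExtraL I₂ I₁ k (flip ∘ R₂)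
    ReadyExtraD-χ⇒ ∞       _            = tt , tt
    ReadyExtraD-χ⇒ (fin k) (even , odd) =
      (λ s₁ s₂ r → (λ e → CondA-χ⇒ (proj₁ (even e) s₁ s₂ r)) ,
                   (λ o → CondB-χ⇒ (proj₁ (odd o) s₁ s₂ r))) ,
      (λ s₂ s₁ r → (λ e → CondB-χ⇒ (proj₂ (even e) s₁ s₂ r)) ,
                   (λ o → CondA-χ⇒ (proj₂ (odd o) s₁ s₂ r)))

    ReadyExtraL⇒χ : ∀ k {R R′} → ReadyExtraL I₁ I₂ k R → ReadyExtraL I₂ I₁ k R′ →
      ReadyExtraD (χ I₁) (χ I₂) k R (flip ∘ R′)
    ReadyExtraL⇒χ ∞       _     _      = tt
    ReadyExtraL⇒χ (fin k) ready ready′ =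
      (λ e → (λ s₁ s₂ r → CondA-χ⇐ (proj₁ (ready s₁ s₂ r) e)) ,
             (λ s₁ s₂ r → CondB-χ⇐ (proj₁ (ready′ s₂ s₁ r) e))) ,
      (λ o → (λ s₁ s₂ r → CondB-χ⇐ (proj₂ (ready s₁ s₂ r) o)) ,
             (λ s₁ s₂ r → CondA-χ⇐ (proj₂ (ready′ s₂ s₁ r) o)))

    ⊴-χ⇒≈ : ∀ k → χ I₁ ⊴[ k ] χ I₂ → I₁ ≈[ k ] I₂
    ⊴-χ⇒≈ k (R₁ , R₂ , sw) =
      let (sw₁₂ , sw₂₁) = LinSwitchingD-χ⇒ k sw in (R₁ , sw₁₂) , (flip ∘ R₂ , sw₂₁)

    ≈⇒⊴-χ : ∀ k → I₁ ≈[ k ] I₂ → χ I₁ ⊴[ k ] χ I₂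
    ≈⇒⊴-χ k ((R , sw) , (R′ , sw′)) = R , flip ∘ R′ , LinSwitchingL⇒χ k sw sw′

    ⊴ʳ-χ⇒≈ʳ : ∀ k → χ I₁ ⊴ʳ[ k ] χ I₂ → I₁ ≈ʳ[ k ] I₂
    ⊴ʳ-χ⇒≈ʳ k (R₁ , R₂ , sw , ready) =
      let (sw₁₂ , sw₂₁) = LinSwitchingD-χ⇒ k sw ; (ready₁₂ , ready₂₁) = ReadyExtraD-χ⇒ k ready
      in (R₁ , sw₁₂ , ready₁₂) , (flip ∘ R₂ , sw₂₁ , ready₂₁)

    ≈ʳ⇒⊴ʳ-χ : ∀ k → I₁ ≈ʳ[ k ] I₂ → χ I₁ ⊴ʳ[ k ] χ I₂
    ≈ʳ⇒⊴ʳ-χ k ((R , sw , ready) , (R′ , sw′ , ready′)) =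
      R , flip ∘ R′ , LinSwitchingL⇒χ k sw sw′ , ReadyExtraL⇒χ k ready ready′

theorem3 : (m : ℕ) → let open Theory (Fin m) in
    (k : ℕ∞) →
      (IsSpecTheory χ (λ D₁ D₂ → D₁ ⊴[ k ] D₂) ×
       AdequateFor χ (λ D₁ D₂ → D₁ ⊴[ k ] D₂) (λ I₁ I₂ → I₁ ≈[ k ] I₂)) ×
      (IsSpecTheory χ (λ D₁ D₂ → D₁ ⊴ʳ[ k ] D₂) ×
       AdequateFor χ (λ D₁ D₂ → D₁ ⊴ʳ[ k ] D₂) (λ I₁ I₂ → I₁ ≈ʳ[ k ] I₂))
theorem3 m k =
  adequateSpecTheory χ _ _ (⊴-refl k) (⊴-trans k)
    (λ _ _ → ⊴-χ⇒≈ k) (λ _ _ → ≈⇒⊴-χ k) (λ _ _ → swap) ,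
  adequateSpecTheory χ _ _ (⊴ʳ-refl k) (⊴ʳ-trans k)
    (λ _ _ → ⊴ʳ-χ⇒≈ʳ k) (λ _ _ → ≈ʳ⇒⊴ʳ-χ k) (λ _ _ → swap)
  where open Theory (Fin m)
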